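{- Let $a_1,\dots,a_n$ be positive integers and $\epsilon_1,\dots,\epsilon_n\in\{+1,-1\}$. The signed pattern $[\epsilon_1a_1,\dots,\epsilon_na_n]$ is weakly realizable if and only if for every pair of indices $1\le i<j\le n$, the subpattern $[\epsilon_ia_i,\epsilon_{i+1}a_{i+1},\dots,\epsilon_ja_j]$ satisfies both the Divisibility condition and the Parity condition.
   Context: $\nu_2(n)$ denotes the exponent of $2$ in the positive integer $n$. A signed pattern is a finite sequence $[\epsilon_1a_1,\dots,\epsilon_na_n]$ of positive integers $a_k$ with signs $\epsilon_k\in\{+1,-1\}$. It is weakly realizable if there exists an integer $T\ge0$ such that, setting $T_0=T$ and $T_k=T_{k-1}+\epsilon_ka_k$, for each $k=1,\dots,n$ the number $T_{k-1}$ is an even multiple of $a_k$ ($0$ counts as an even multiple) when $\epsilon_k=+1$, and an odd multiple of $a_k$ when $\epsilon_k=-1$. (Equivalently, each step $T_{k-1}\to T_k$ traverses an edge $\{2ja_k,(2j+1)a_k\}$, $j\ge0$, of a skip graph; repetitions of vertices or edges are allowed.) For a signed pattern $[\epsilon_1b_1,\dots,\epsilon_mb_m]$ with $m\ge2$, let $g=\gcd(b_1,b_m)$ and let $I=\sum_{k=2}^{m-1}\epsilon_kb_k$ (so $I=0$ if $m=2$). The pattern satisfies the Divisibility condition if $g\mid I$. Given Divisibility, it satisfies the Parity condition if: $I/g$ is even if and only if the following statement holds: "if $\nu_2(b_1)<\nu_2(b_m)$ then $\epsilon_1=-1$; if $\nu_2(b_1)>\nu_2(b_m)$ then $\epsilon_m=+1$;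 if $\nu_2(b_1)=\nu_2(b_m)$ then $\epsilon_1=-\epsilon_m$." -}

module Defs where

open import Data.Nat as ℕ using (ℕ; zero; suc; _<_)
open import Data.Nat.GCD using (gcd)
open import Data.Integer as ℤ using (ℤ; +_; _+_; _*_; -_)
open import Data.Integer.Divisibility using () renaming (_∣_ to _∣ℤ_)
open import Data.Fin as Fin using (Fin; toℕ)
open import Data.List using (List; foldr; map; filter; allFin)
open import Data.Sign using (Sign) using (opposite) renaming (+ to plus; - to minus)
open import Data.Product using (Σ; _×_; _,_; ∃)
open import Data.Sum using (_⊎_)
open import Relation.Binary.PropositionalEquality using (_≡_)
open import Relation.Nullary using (¬_)
open import Data.Nat.Properties using (_<?_)
open import Function using (_⇔_)

-- 2-adic valuation of a natural number (meaningful for positive n; ν₂ 0 is unspecified)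
-- Defined relationally: ν₂ n ≡ e iff 2^e ∣ n and n/2^e odd.
-- n = 2^e * (2q+1)
Nu2 : ℕ → ℕ → Set
Nu2 n e = Σ ℕ λ q → n ≡ (2 ℕ.^ e) ℕ.* (2 ℕ.* q ℕ.+ 1)

sumℤ : List ℤ → ℤ
sumℤ = foldr _+_ (+ 0)

signed : Sign → ℕ → ℤ
signed plus  a = + a
signed minus a = - (+ a)

inner : ∀ {n} → (Fin n → Sign) → (Fin n → ℕ) → Fin n → Fin n → ℤ
inner {n} ε a i j =
  sumℤ
    (map (λ k → signed (ε k) (a k))
      (filter (λ k → toℕ i <? toℕ k) (filter (λ k → toℕ k <? toℕ j) (allFin n))))

prefix : ∀ {n} → (Fin n → Sign) → (Fin n → ℕ) → Fin n → ℤ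
prefix {n} ε a k =
  sumℤ
    (map (λ l → signed (ε l) (a l)) (filter (λ l → toℕ l <? toℕ k) (allFin n)))

EvenMultiple : ℤ → ℕ → Set
EvenMultiple x a = Σ ℕ λ j → x ≡ + (2 ℕ.* j ℕ.* a)

OddMultiple : ℤ → ℕ → Set
OddMultiple x a = Σ ℕ λ j → x ≡ + ((2 ℕ.* j ℕ.+ 1) ℕ.* a)

StepOK : Sign → ℤ → ℕ → Set
StepOK plus  x a = EvenMultiple x a
StepOK minus x a = OddMultiple x a

-- weak realizability: ∃ T ≥ 0 such that T_{k-1} = T + Σ_{l<k} ε_l a_l satisfies the step condition
WeaklyRealizable : ∀ {n} → (Fin n → Sign) → (Fin n → ℕ) → Set
WeaklyRealizable ε a = Σ ℕ λ T → ∀ k → StepOK (ε k) (+ T + prefix ε a k) (a k)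

EndpointStatement : Sign → ℕ → Sign → ℕ → Set
EndpointStatement e₁ b₁ eₘ bₘ =
  ∀ v₁ vₘ → Nu2 b₁ v₁ → Nu2 bₘ vₘ →
    (v₁ < vₘ → e₁ ≡ minus) × (vₘ < v₁ → eₘ ≡ plus) × (v₁ ≡ vₘ → e₁ ≡ opposite eₘ)

Divisibility : ∀ {n} → (Fin n → Sign) → (Fin n → ℕ) → Fin n → Fin n → Set
Divisibility ε a i j = + gcd (a i) (a j) ∣ℤ inner ε a i j

EvenInt : ℤ → Set
EvenInt q = Σ ℤ λ r → q ≡ + 2 * r

Parity : ∀ {n} → (Fin n → Sign) → (Fin n → ℕ) → Fin n → Fin n → Set
Parity ε a i j =
  ∀ q → inner ε a i j ≡ q * + gcd (a i) (a j) →
    (EvenInt q ⇔ EndpointStatement (ε i) (a i) (ε j) (a j))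

module Submission where

-- A step of sign + by a leads from an even to an odd multiple of a, a step of sign - back, so T
-- realizes the pattern iff T + P_k ≡ c_k a_k (mod 2a_k) for every k, where P_k is the k-th partial
-- sum and c_k ∈ {0,1} records the sign; nonnegativity is free, as solutions can be shifted by a common
-- multiple of the moduli. By the Chinese remainder theorem for arbitrary moduli the system is
-- solvable iff every two of its congruences agree modulo gcd(2a_i, 2a_j) = 2g. For i < j, with
-- inner sum I, this says 2g ∣ I + d_i a_i - c_j a_j (d = 1 - c): thus g ∣ I, and writing I = qg,
-- a_i = αg, a_j = βg, it says that q and d_i α - c_j β have the same parity. As α and β are coprime,
-- the comparison of the 2-adic valuations of a_i and a_j decides which of α, β is odd, and then the
-- parity of d_i α - c_j β is exactly the statement of the Parity condition.

open import Defs
open import Data.Nat as ℕ using (ℕ; zero; suc; _<_; NonZero; z≤n; s≤s)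
open import Data.Nat.Properties as ℕ using (even≢odd)
open import Data.Nat.Divisibility as ℕ using (divides)
open import Data.Nat.DivMod using (_/_; m/n*n≡m)
open import Data.Nat.GCD
  using (gcd; gcd-GCD; gcd-comm; gcd[m,n]∣m; gcd[m,n]∣n; gcd[m,n]≢0; m/gcd[m,n]≢0; n/gcd[m,n]≢0;
         c*gcd[m,n]≡gcd[cm,cn]; module Bézout)
open import Data.Nat.Coprimality using (coprime-/gcd)
open import Data.Nat.Induction using (<-rec)
open import Data.Nat.ListAction using (product)
open import Data.Nat.ListAction.Properties using (∈⇒∣product; product≢0)
open import Data.Nat.Tactic.RingSolver using () renaming (solve-∀ to ℕ-solve-∀)
open import Data.Integer as ℤ using (ℤ; +_; -[1+_]; -_; _+_; _*_; _-_; _%ℕ_; _/ℕ_; +≤+)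
open import Data.Integer.Properties as ℤ using ()
open import Data.Integer.DivMod using (a≡a%ℕn+[a/ℕn]*n; n%ℕd<d)
open import Data.Integer.Divisibility using () renaming (_∣_ to _∣ᵤ_)
open import Data.Integer.Divisibility.Signed
  using (_∣_; divides; _∣?_; ∣ᵤ⇒∣; ∣⇒∣ᵤ; ∣-trans; ∣m∣n⇒∣m+n; ∣m∣n⇒∣m-n; ∣n⇒∣m*n;
         ∣m+n∣m⇒∣n; ∣m+n∣n⇒∣m; ∣m⇒∣-m; *-monoˡ-∣; *-cancelʳ-∣)
open import Data.Integer.Tactic.RingSolver using (solve-∀)
open import Data.Fin using (Fin; zero; suc; fromℕ; inject₁; toℕ)
open import Data.Fin.Properties using (toℕ-injective)
open import Data.Fin.Relation.Unary.Top using (view; ‵fromℕ; ‵inject₁)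
open import Data.List using (List; []; _∷_; map; filter; allFin; tabulate)
open import Data.List.Properties using (map-cong; map-tabulate)
open import Data.List.Membership.Propositional.Properties using (∈-tabulate⁺)
open import Data.List.Relation.Unary.All.Properties using (tabulate⁺)
open import Data.Bool using (Bool; true; false; if_then_else_)
open import Data.Sign using (Sign; opposite) renaming (+ to plus; - to minus)
open import Data.Product using (∃; ∃₂; _×_; _,_)
open import Data.Sum using (_⊎_; inj₁; inj₂)
open import Function using (_∘_; _⇔_; mk⇔; Equivalence)
open import Function.Properties.Equivalence using (⇔-setoid) renaming (trans to ⇔-trans; sym to ⇔-sym)
open import Level using (0ℓ)
open import Relation.Binary using (tri<; tri≈; tri>)
open import Relation.Binary.PropositionalEquality
import Relation.Binary.Reasoning.Setoid as SetoidReasoning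
open import Relation.Nullary using (¬_; yes; no; does; contradiction)
open import Relation.Unary using (Pred; Decidable)

open Equivalence

-- Parity of integers

EvenInt⇔2∣ : ∀ {z} → EvenInt z ⇔ + 2 ∣ z
EvenInt⇔2∣ = mk⇔ (λ (r , z≡2r) → divides r (trans z≡2r (ℤ.*-comm (+ 2) r)))
                 (λ (divides r z≡r2) → r , trans z≡r2 (ℤ.*-comm r (+ 2)))

2∤⇒odd : ∀ {z} → ¬ + 2 ∣ z → ∃ λ q → z ≡ + 1 + q * + 2
2∤⇒odd {z} 2∤z with z %ℕ 2 | a≡a%ℕn+[a/ℕn]*n z 2 | n%ℕd<d z 2
... | 0             | z≡ | _ = contradiction (divides (z /ℕ 2) (trans z≡ (ℤ.+-identityˡ _))) 2∤z
... | 1             | z≡ | _ = z /ℕ 2 , z≡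
... | suc (suc _)   | _  | s≤s (s≤s ())

2∣-i⇔2∣i : ∀ {z} → + 2 ∣ - z ⇔ + 2 ∣ z
2∣-i⇔2∣i {z} = mk⇔ (λ 2∣-z → subst (+ 2 ∣_) (ℤ.neg-involutive z) (∣m⇒∣-m 2∣-z)) ∣m⇒∣-m

2∣m+n⇔ : ∀ m n → + 2 ∣ m + n ⇔ (+ 2 ∣ m ⇔ + 2 ∣ n)
2∣m+n⇔ m n = mk⇔
  (λ 2∣m+n → mk⇔ (∣m+n∣m⇒∣n 2∣m+n) (∣m+n∣n⇒∣m 2∣m+n))
  both
  where
  both : (+ 2 ∣ m ⇔ + 2 ∣ n) → + 2 ∣ m + n
  both m⇔n with + 2 ∣? m
  ... | yes 2∣m = ∣m∣n⇒∣m+n 2∣m (to m⇔n 2∣m)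
  ... | no 2∤m with 2∤⇒odd 2∤m | 2∤⇒odd (λ 2∣n → 2∤m (from m⇔n 2∣n))
  ... | q , refl | r , refl = divides (q + r + + 1) (odd+odd q r)
    where
    odd+odd : ∀ q r → + 1 + q * + 2 + (+ 1 + r * + 2) ≡ (q + r + + 1) * + 2
    odd+odd = solve-∀

2∣m-n⇔ : ∀ m n → + 2 ∣ m - n ⇔ (+ 2 ∣ m ⇔ + 2 ∣ n)
2∣m-n⇔ m n = mk⇔ (λ h → ⇔-trans (to (2∣m+n⇔ m (- n)) h) 2∣-i⇔2∣i)
               (λ m⇔n → from (2∣m+n⇔ m (- n)) (⇔-trans m⇔n (⇔-sym 2∣-i⇔2∣i)))

-- 2-adic valuations

even⊎odd : ∀ n → (∃ λ q → n ≡ 2 ℕ.* q) ⊎ (∃ λ q → n ≡ 2 ℕ.* q ℕ.+ 1)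
even⊎odd zero = inj₁ (0 , refl)
even⊎odd (suc n) with even⊎odd n
... | inj₁ (q , refl) = inj₂ (q , ℕ.+-comm 1 (2 ℕ.* q))
... | inj₂ (q , refl) = inj₁ (suc q , 1+[2q+1]≡2[1+q] q)
  where
  1+[2q+1]≡2[1+q] : ∀ q → suc (2 ℕ.* q ℕ.+ 1) ≡ 2 ℕ.* suc q
  1+[2q+1]≡2[1+q] = ℕ-solve-∀

Nu2-0⇒2∤ : ∀ {n} → Nu2 n 0 → ¬ 2 ℕ.∣ n
Nu2-0⇒2∤ {n} (q , n≡2q+1) (divides k n≡k*2) = even≢odd k q (begin
  2 ℕ.* k           ≡⟨ ℕ.*-comm 2 k ⟩
  k ℕ.* 2           ≡⟨ sym n≡k*2 ⟩
  n                 ≡⟨ n≡2q+1 ⟩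
  1 ℕ.* (2 ℕ.* q ℕ.+ 1) ≡⟨ ℕ.*-identityˡ _ ⟩
  2 ℕ.* q ℕ.+ 1     ≡⟨ ℕ.+-comm _ 1 ⟩
  suc (2 ℕ.* q)     ∎)
  where open ≡-Reasoning

Nu2-suc⇒2∣ : ∀ {n v} → Nu2 n (suc v) → 2 ℕ.∣ n
Nu2-suc⇒2∣ {v = v} (q , n≡) = divides (2 ℕ.^ v ℕ.* (2 ℕ.* q ℕ.+ 1))
  (trans n≡ (trans (ℕ.*-assoc 2 (2 ℕ.^ v) _) (ℕ.*-comm 2 (2 ℕ.^ v ℕ.* _))))

Nu2-pos⇒2∣ : ∀ {n v} → 0 < v → Nu2 n v → 2 ℕ.∣ n
Nu2-pos⇒2∣ {v = suc v} _ = Nu2-suc⇒2∣ {v = v}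

Nu2-double : ∀ {m v} → Nu2 m v → Nu2 (2 ℕ.* m) (suc v)
Nu2-double {v = v} (q , m≡) = q , trans (cong (2 ℕ.*_) m≡) (sym (ℕ.*-assoc 2 (2 ℕ.^ v) _))

Nu2-unique : ∀ {n v w} → Nu2 n v → Nu2 n w → v ≡ w
Nu2-unique {v = zero}  {zero}  _  _  = refl
Nu2-unique {v = zero}  {suc w} nv nw = contradiction (Nu2-suc⇒2∣ {v = w} nw) (Nu2-0⇒2∤ nv)
Nu2-unique {v = suc v} {zero}  nv nw = contradiction (Nu2-suc⇒2∣ {v = v} nv) (Nu2-0⇒2∤ nw)
Nu2-unique {v = suc v} {suc w} (p , n≡) (q , n≡′) = cong suc (Nu2-unique (p , refl) (q , halves))
  where
  halves : 2 ℕ.^ v ℕ.* (2 ℕ.* p ℕ.+ 1) ≡ 2 ℕ.^ w ℕ.* (2 ℕ.* q ℕ.+ 1)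
  halves = ℕ.*-cancelˡ-≡ _ _ 2
    (trans (sym (ℕ.*-assoc 2 (2 ℕ.^ v) _)) (trans (sym n≡) (trans n≡′ (ℕ.*-assoc 2 (2 ℕ.^ w) _))))

n<2*n : ∀ {n} → 0 < n → n < 2 ℕ.* n
n<2*n {n} 0<n = subst (n <_) (ℕ.*-comm n 2) (ℕ.m<m*n n 2 {{ℕ.>-nonZero 0<n}} (s≤s (s≤s z≤n)))

Nu2-exists : ∀ n → .{{NonZero n}} → ∃ (Nu2 n)
Nu2-exists = <-rec (λ n → .{{NonZero n}} → ∃ (Nu2 n)) step
  where
  step : ∀ n → (∀ {m} → m < n → .{{NonZero m}} → ∃ (Nu2 m)) → .{{NonZero n}} → ∃ (Nu2 n)
  step n rec with even⊎odd n
  ... | inj₂ (q , n≡2q+1) = 0 , q , trans n≡2q+1 (sym (ℕ.*-identityˡ _))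
  ... | inj₁ (m , refl) with rec (n<2*n (ℕ.>-nonZero⁻¹ m {{m≢0}})) {{m≢0}}
    where
    m≢0 : NonZero m
    m≢0 = ℕ.m*n≢0⇒n≢0 2
  ... | v , νm = suc v , Nu2-double {v = v} νm

Nu2-* : ∀ {m n v w} → Nu2 m v → Nu2 n w → Nu2 (m ℕ.* n) (v ℕ.+ w)
Nu2-* {m} {n} {v} {w} (p , m≡) (q , n≡) = 2 ℕ.* p ℕ.* q ℕ.+ p ℕ.+ q , (begin
  m ℕ.* n ≡⟨ cong₂ ℕ._*_ m≡ n≡ ⟩
  (2 ℕ.^ v ℕ.* (2 ℕ.* p ℕ.+ 1)) ℕ.* (2 ℕ.^ w ℕ.* (2 ℕ.* q ℕ.+ 1))
    ≡⟨ odd*odd (2 ℕ.^ v) (2 ℕ.^ w) p q ⟩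
  (2 ℕ.^ v ℕ.* 2 ℕ.^ w) ℕ.* (2 ℕ.* (2 ℕ.* p ℕ.* q ℕ.+ p ℕ.+ q) ℕ.+ 1)
    ≡⟨ cong (ℕ._* _) (sym (ℕ.^-distribˡ-+-* 2 v w)) ⟩
  2 ℕ.^ (v ℕ.+ w) ℕ.* (2 ℕ.* (2 ℕ.* p ℕ.* q ℕ.+ p ℕ.+ q) ℕ.+ 1) ∎)
  where
  open ≡-Reasoning
  odd*odd : ∀ A B p q → (A ℕ.* (2 ℕ.* p ℕ.+ 1)) ℕ.* (B ℕ.* (2 ℕ.* q ℕ.+ 1))
                      ≡ (A ℕ.* B) ℕ.* (2 ℕ.* (2 ℕ.* p ℕ.* q ℕ.+ p ℕ.+ q) ℕ.+ 1)
  odd*odd = ℕ-solve-∀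

-- Parity of the endpoint offsets

-- A step of sign e by a traverses an edge {2ja, (2j+1)a}: modulo 2a it goes from source e a to
-- target e a.
source target : Sign → ℕ → ℤ
source plus  a = + 0
source minus a = + a
target plus  a = + a
target minus a = + 0

source+signed : ∀ e a → source e a + signed e a ≡ target e a
source+signed plus  a = refl
source+signed minus a = ℤ.+-inverseʳ (+ a)

source-* : ∀ e m n → source e (m ℕ.* n) ≡ source e m * + n
source-* plus  m n = refl
source-* minus m n = ℤ.pos-* m n

target-* : ∀ e m n → target e (m ℕ.* n) ≡ target e m * + n
target-* plus  m n = ℤ.pos-* m n
target-* minus m n = refl

offset : Sign → Sign → ℕ → ℕ → ℤ
offset e f α β = target e α - source f β

2∣0 : + 2 ∣ + 0
2∣0 = divides (+ 0) refl

2∣target⇔ : ∀ e {α} → ¬ 2 ℕ.∣ α → + 2 ∣ target e α ⇔ e ≡ minus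
2∣target⇔ plus  2∤α = mk⇔ (λ 2∣α → contradiction (∣⇒∣ᵤ 2∣α) 2∤α) (λ ())
2∣target⇔ minus 2∤α = mk⇔ (λ _ → refl) (λ _ → 2∣0)

2∣source⇔ : ∀ f {β} → ¬ 2 ℕ.∣ β → + 2 ∣ source f β ⇔ f ≡ plus
2∣source⇔ plus  2∤β = mk⇔ (λ _ → refl) (λ _ → 2∣0)
2∣source⇔ minus 2∤β = mk⇔ (λ 2∣β → contradiction (∣⇒∣ᵤ 2∣β) 2∤β) (λ ())

2∣target : ∀ e {α} → 2 ℕ.∣ α → + 2 ∣ target e α
2∣target plus  2∣α = ∣ᵤ⇒∣ 2∣α
2∣target minus 2∣α = 2∣0

2∣source : ∀ f {β} → 2 ℕ.∣ β → + 2 ∣ source f β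
2∣source plus  2∣β = 2∣0
2∣source minus 2∣β = ∣ᵤ⇒∣ 2∣β

≡opposite⇔ : ∀ e f → (e ≡ minus ⇔ f ≡ plus) ⇔ e ≡ opposite f
≡opposite⇔ plus  plus  = mk⇔ (λ e → from e refl) (λ ())
≡opposite⇔ plus  minus = mk⇔ (λ _ → refl) (λ _ → mk⇔ (λ ()) (λ ()))
≡opposite⇔ minus plus  = mk⇔ (λ _ → refl) (λ _ → mk⇔ (λ _ → refl) (λ _ → refl))
≡opposite⇔ minus minus = mk⇔ (λ e → to e refl) (λ ())

2∣offset⇔-odd-even : ∀ e f {α β} → ¬ 2 ℕ.∣ α → 2 ℕ.∣ β → + 2 ∣ offset e f α β ⇔ e ≡ minus
2∣offset⇔-odd-even e f 2∤α 2∣β = ⇔-trans (2∣m-n⇔ _ _)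
  (mk⇔ (λ t⇔s → to (2∣target⇔ e 2∤α) (from t⇔s (2∣source f 2∣β)))
       (λ e≡ → mk⇔ (λ _ → 2∣source f 2∣β) (λ _ → from (2∣target⇔ e 2∤α) e≡)))

2∣offset⇔-even-odd : ∀ e f {α β} → 2 ℕ.∣ α → ¬ 2 ℕ.∣ β → + 2 ∣ offset e f α β ⇔ f ≡ plus
2∣offset⇔-even-odd e f 2∣α 2∤β = ⇔-trans (2∣m-n⇔ _ _)
  (mk⇔ (λ t⇔s → to (2∣source⇔ f 2∤β) (to t⇔s (2∣target e 2∣α)))
       (λ f≡ → mk⇔ (λ _ → from (2∣source⇔ f 2∤β) f≡) (λ _ → 2∣target e 2∣α)))

2∣offset⇔-odd-odd : ∀ e f {α β} → ¬ 2 ℕ.∣ α → ¬ 2 ℕ.∣ β →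
                    + 2 ∣ offset e f α β ⇔ e ≡ opposite f
2∣offset⇔-odd-odd e f 2∤α 2∤β = ⇔-trans (2∣m-n⇔ _ _) (⇔-trans (mk⇔
  (λ t⇔s → ⇔-trans (⇔-sym (2∣target⇔ e 2∤α)) (⇔-trans t⇔s (2∣source⇔ f 2∤β)))
  (λ e⇔f → ⇔-trans (2∣target⇔ e 2∤α) (⇔-trans e⇔f (⇔-sym (2∣source⇔ f 2∤β)))))
  (≡opposite⇔ e f))

EndpointRule : Sign → Sign → ℕ → ℕ → Set
EndpointRule e f v w = (v < w → e ≡ minus) × (w < v → f ≡ plus) × (v ≡ w → e ≡ opposite f)

EndpointStatement⇔EndpointRule : ∀ {e a f b v w} → Nu2 a v → Nu2 b w →
                         EndpointStatement e a f b ⇔ EndpointRule e f v w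
EndpointStatement⇔EndpointRule {e} {f = f} νa νb = mk⇔ (λ stmt → stmt _ _ νa νb)
  (λ rule _ _ νa′ νb′ → subst₂ (EndpointRule e f) (Nu2-unique νa νa′) (Nu2-unique νb νb′) rule)

EndpointRule-+ʳ : ∀ e f v w c → EndpointRule e f (v ℕ.+ c) (w ℕ.+ c) ⇔ EndpointRule e f v w
EndpointRule-+ʳ e f v w c = mk⇔
  (λ (r< , r> , r≡) → (λ v<w → r< (ℕ.+-monoˡ-< c v<w)) ,
                       (λ w<v → r> (ℕ.+-monoˡ-< c w<v)) ,
                       (λ v≡w → r≡ (cong (ℕ._+ c) v≡w)))
  (λ (r< , r> , r≡) → (λ lt → r< (ℕ.+-cancelʳ-< c v w lt)) ,
                       (λ gt → r> (ℕ.+-cancelʳ-< c w v gt)) ,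
                       (λ eq → r≡ (ℕ.+-cancelʳ-≡ c v w eq)))

EndpointRule-< : ∀ {e f v w} → v < w → EndpointRule e f v w ⇔ e ≡ minus
EndpointRule-< v<w = mk⇔ (λ (r< , _) → r< v<w)
  (λ e≡ → (λ _ → e≡) ,
           (λ w<v → contradiction w<v (ℕ.<-asym v<w)) ,
           (λ v≡w → contradiction v≡w (ℕ.<⇒≢ v<w)))

EndpointRule-> : ∀ {e f v w} → w < v → EndpointRule e f v w ⇔ f ≡ plus
EndpointRule-> w<v = mk⇔ (λ (_ , r> , _) → r> w<v)
  (λ f≡ → (λ v<w → contradiction v<w (ℕ.<-asym w<v)) ,
           (λ _ → f≡) ,
           (λ v≡w → contradiction (sym v≡w) (ℕ.<⇒≢ w<v)))

EndpointRule-≡ : ∀ {e f v w} → v ≡ w → EndpointRule e f v w ⇔ e ≡ opposite f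
EndpointRule-≡ v≡w = mk⇔ (λ (_ , _ , r≡) → r≡ v≡w)
  (λ e≡ → (λ v<w → contradiction v≡w (ℕ.<⇒≢ v<w)) ,
           (λ w<v → contradiction (sym v≡w) (ℕ.<⇒≢ w<v)) ,
           (λ _ → e≡))

-- As α and β are not both even, the smaller of the valuations s and t is 0.
2∣offset⇔EndpointRule : ∀ e f {α β s t} → ¬ (2 ℕ.∣ α × 2 ℕ.∣ β) → Nu2 α s → Nu2 β t →
                        + 2 ∣ offset e f α β ⇔ EndpointRule e f s t
2∣offset⇔EndpointRule e f {α} {β} {s} {t} not-both να νβ with ℕ.<-cmp s t
... | tri< s<t _ _ = ⇔-trans (2∣offset⇔-odd-even e f (λ 2∣α → not-both (2∣α , 2∣β)) 2∣β)
                             (⇔-sym (EndpointRule-< s<t))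
  where
  2∣β : 2 ℕ.∣ β
  2∣β = Nu2-pos⇒2∣ (ℕ.≤-<-trans z≤n s<t) νβ
... | tri> _ _ t<s = ⇔-trans (2∣offset⇔-even-odd e f 2∣α (λ 2∣β → not-both (2∣α , 2∣β)))
                             (⇔-sym (EndpointRule-> t<s))
  where
  2∣α : 2 ℕ.∣ α
  2∣α = Nu2-pos⇒2∣ (ℕ.≤-<-trans z≤n t<s) να
... | tri≈ _ refl _ with s
...   | zero  = ⇔-trans (2∣offset⇔-odd-odd e f (Nu2-0⇒2∤ να) (Nu2-0⇒2∤ νβ))
                        (⇔-sym (EndpointRule-≡ refl))
...   | suc s = contradiction (Nu2-suc⇒2∣ {v = s} να , Nu2-suc⇒2∣ {v = s} νβ) not-both

module _ (a b : ℕ) .{{_ : NonZero a}} .{{_ : NonZero b}} where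

  private
    g : ℕ
    g = gcd a b

    instance
      g≢0 : NonZero g
      g≢0 = ℕ.≢-nonZero (gcd[m,n]≢0 a b (inj₁ (ℕ.≢-nonZero⁻¹ a)))

    α β : ℕ
    α = a / g
    β = b / g

    instance
      α≢0 : NonZero α
      α≢0 = ℕ.≢-nonZero (m/gcd[m,n]≢0 a b)
      β≢0 : NonZero β
      β≢0 = ℕ.≢-nonZero (n/gcd[m,n]≢0 a b)

    a≡α*g : a ≡ α ℕ.* g
    a≡α*g = sym (m/n*n≡m (gcd[m,n]∣m a b))

    b≡β*g : b ≡ β ℕ.* g
    b≡β*g = sym (m/n*n≡m (gcd[m,n]∣n a b))

    cofactors-not-both-even : ¬ (2 ℕ.∣ α × 2 ℕ.∣ β)
    cofactors-not-both-even 2∣both with () ← coprime-/gcd a b 2∣both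

    Nu2-cofactor : ∀ {m n} v w → m ≡ n ℕ.* g → Nu2 n v → Nu2 g w → Nu2 m (v ℕ.+ w)
    Nu2-cofactor v w refl νn νg = Nu2-* {v = v} {w} νn νg

  EndpointStatement⇔2∣offset : ∀ e f → EndpointStatement e a f b ⇔ + 2 ∣ offset e f α β
  EndpointStatement⇔2∣offset e f
    with s , να ← Nu2-exists α | t , νβ ← Nu2-exists β | c , νg ← Nu2-exists g =
    ⇔-trans (EndpointStatement⇔EndpointRule {v = s ℕ.+ c} {t ℕ.+ c}
               (Nu2-cofactor s c a≡α*g να νg) (Nu2-cofactor t c b≡β*g νβ νg))
      (⇔-trans (EndpointRule-+ʳ e f s t c)
               (⇔-sym (2∣offset⇔EndpointRule e f cofactors-not-both-even να νβ)))

  private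
    endpoints≡ : ∀ e f → target e a - source f b ≡ offset e f α β * + g
    endpoints≡ e f = begin
      target e a - source f b                 ≡⟨ cong₂ (λ x y → target e x - source f y) a≡α*g b≡β*g ⟩
      target e (α ℕ.* g) - source f (β ℕ.* g) ≡⟨ cong₂ _-_ (target-* e α g) (source-* f β g) ⟩
      target e α * + g - source f β * + g     ≡⟨ *-distribʳ-- (target e α) (source f β) (+ g) ⟩
      offset e f α β * + g                    ∎
      where
      open ≡-Reasoning
      *-distribʳ-- : ∀ x y z → x * z - y * z ≡ (x - y) * z
      *-distribʳ-- = solve-∀

    2g∣⇔2∣ : ∀ {I} q d → I ≡ q * + g → + (2 ℕ.* g) ∣ I + d * + g ⇔ + 2 ∣ q + d
    2g∣⇔2∣ q d refl = subst (λ x → + (2 ℕ.* g) ∣ x ⇔ + 2 ∣ q + d) (ℤ.*-distribʳ-+ (+ g) q d)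
      (subst (λ y → y ∣ (q + d) * + g ⇔ + 2 ∣ q + d) (sym (ℤ.pos-* 2 g))
        (mk⇔ (*-cancelʳ-∣ (+ g)) (*-monoˡ-∣ (+ g))))

  2gcd∣⇔divisibility×parity : ∀ e f (I : ℤ) →
    + (2 ℕ.* g) ∣ I + (target e a - source f b) ⇔
    (+ g ∣ᵤ I × (∀ q → I ≡ q * + g → (EvenInt q ⇔ EndpointStatement e a f b)))
  2gcd∣⇔divisibility×parity e f I = mk⇔ forward backward
    where
    δ : ℤ
    δ = offset e f α β

    forward : + (2 ℕ.* g) ∣ I + (target e a - source f b) →
              + g ∣ᵤ I × (∀ q → I ≡ q * + g → (EvenInt q ⇔ EndpointStatement e a f b))
    forward 2g∣ = ∣⇒∣ᵤ g∣I , parity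
      where
      2g∣I+δg : + (2 ℕ.* g) ∣ I + δ * + g
      2g∣I+δg = subst (λ x → + (2 ℕ.* g) ∣ I + x) (endpoints≡ e f) 2g∣
      g∣I : + g ∣ I
      g∣I = ∣m+n∣n⇒∣m (∣-trans (divides (+ 2) (ℤ.pos-* 2 g)) 2g∣I+δg) (divides δ refl)
      parity : ∀ q → I ≡ q * + g → (EvenInt q ⇔ EndpointStatement e a f b)
      parity q I≡ = ⇔-trans EvenInt⇔2∣
        (⇔-trans (to (2∣m+n⇔ q δ) (to (2g∣⇔2∣ q δ I≡) 2g∣I+δg))
                 (⇔-sym (EndpointStatement⇔2∣offset e f)))

    backward : + g ∣ᵤ I × (∀ q → I ≡ q * + g → (EvenInt q ⇔ EndpointStatement e a f b)) →
               + (2 ℕ.* g) ∣ I + (target e a - source f b)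
    backward (g∣I , parity) with divides q I≡ ← ∣ᵤ⇒∣ g∣I =
      subst (λ x → + (2 ℕ.* g) ∣ I + x) (sym (endpoints≡ e f))
        (from (2g∣⇔2∣ q δ I≡) (from (2∣m+n⇔ q δ)
          (⇔-trans (⇔-sym EvenInt⇔2∣) (⇔-trans (parity q I≡) (EndpointStatement⇔2∣offset e f)))))

-- Congruences and the Chinese remainder theorem

infix 4 _≡_mod_

record _≡_mod_ (x y : ℤ) (m : ℕ) : Set where
  constructor mk≡mod
  field m∣x-y : + m ∣ x - y

≡-mod-refl : ∀ {x m} → x ≡ x mod m
≡-mod-refl {x} = mk≡mod (divides (+ 0) (ℤ.+-inverseʳ x))

≡-mod-sym : ∀ {x y m} → x ≡ y mod m → y ≡ x mod m
≡-mod-sym {x} {y} {m} (mk≡mod m∣x-y) = mk≡mod (subst (+ m ∣_) (-[x-y]≡y-x x y) (∣m⇒∣-m m∣x-y))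
  where
  -[x-y]≡y-x : ∀ x y → - (x - y) ≡ y - x
  -[x-y]≡y-x = solve-∀

≡-mod-trans : ∀ {x y z m} → x ≡ y mod m → y ≡ z mod m → x ≡ z mod m
≡-mod-trans {x} {y} {z} {m} (mk≡mod m∣x-y) (mk≡mod m∣y-z) =
  mk≡mod (subst (+ m ∣_) (telescope x y z) (∣m∣n⇒∣m+n m∣x-y m∣y-z))
  where
  telescope : ∀ x y z → (x - y) + (y - z) ≡ x - z
  telescope = solve-∀

≡-mod-∣ : ∀ {x y d m} → d ℕ.∣ m → x ≡ y mod m → x ≡ y mod d
≡-mod-∣ d∣m (mk≡mod m∣x-y) = mk≡mod (∣-trans (∣ᵤ⇒∣ d∣m) m∣x-y)

≡-mod-shift : ∀ x p s {m} → x + p ≡ s mod m ⇔ x ≡ s - p mod m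
≡-mod-shift x p s {m} = mk⇔ (λ (mk≡mod d) → mk≡mod (subst (+ m ∣_) (shift x p s) d))
                            (λ (mk≡mod d) → mk≡mod (subst (+ m ∣_) (sym (shift x p s)) d))
  where
  shift : ∀ x p s → x + p - s ≡ x - (s - p)
  shift = solve-∀

x-y≡z⇒x≡y+z : ∀ x y {z} → x - y ≡ z → x ≡ y + z
x-y≡z⇒x≡y+z x y refl = y+[x-y]≡x x y
  where
  y+[x-y]≡x : ∀ x y → x ≡ y + (x - y)
  y+[x-y]≡x = solve-∀

multiple⇒≡-mod : ∀ {x} c M j → x ≡ + (c ℕ.+ j ℕ.* M) → x ≡ + c mod M
multiple⇒≡-mod {x} c M j x≡ = mk≡mod (divides (+ j) (begin
  x - + c                 ≡⟨ cong (_- + c) x≡ ⟩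
  + (c ℕ.+ j ℕ.* M) - + c ≡⟨ cong (_- + c) (ℤ.pos-+ c (j ℕ.* M)) ⟩
  + c + + (j ℕ.* M) - + c ≡⟨ cong (λ y → + c + y - + c) (ℤ.pos-* j M) ⟩
  + c + + j * + M - + c   ≡⟨ cancel (+ c) (+ j * + M) ⟩
  + j * + M               ∎))
  where
  open ≡-Reasoning
  cancel : ∀ C D → C + D - C ≡ D
  cancel = solve-∀

≡-mod⇒multiple : ∀ {x c M} → ℤ.0ℤ ℤ.≤ x → c < M → x ≡ + c mod M →
                 ∃ λ j → x ≡ + (c ℕ.+ j ℕ.* M)
≡-mod⇒multiple {+ n} {c} {M} _ c<M (mk≡mod (divides (+ j) n-c≡)) = j , (begin
  + n                   ≡⟨ x-y≡z⇒x≡y+z (+ n) (+ c) n-c≡ ⟩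
  + c + + j * + M       ≡⟨ cong (λ y → + c + y) (ℤ.pos-* j M) ⟨
  + c + + (j ℕ.* M)     ≡⟨ ℤ.pos-+ c (j ℕ.* M) ⟨
  + (c ℕ.+ j ℕ.* M)     ∎)
  where open ≡-Reasoning
≡-mod⇒multiple {+ n} {c} {M} _ c<M (mk≡mod (divides -[1+ t ] n-c≡)) =
  contradiction c<M (ℕ.≤⇒≯ M≤c)
  where
  n+[1+t]M≡c : n ℕ.+ suc t ℕ.* M ≡ c
  n+[1+t]M≡c = ℤ.+-injective (begin
    + (n ℕ.+ suc t ℕ.* M)
      ≡⟨ trans (ℤ.pos-+ n _) (cong (λ y → + n + y) (ℤ.pos-* (suc t) M)) ⟩
    + n + + suc t * + M
      ≡⟨ cong (λ y → y + + suc t * + M) (x-y≡z⇒x≡y+z (+ n) (+ c) n-c≡) ⟩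
    + c + (- + suc t) * + M + + suc t * + M
      ≡⟨ cancel (+ c) (+ suc t) (+ M) ⟩
    + c ∎)
    where
    open ≡-Reasoning
    cancel : ∀ C T M → C + (- T) * M + T * M ≡ C
    cancel = solve-∀
  M≤c : M ℕ.≤ c
  M≤c = ℕ.≤-trans (ℕ.m≤n*m M (suc t)) (ℕ.≤-trans (ℕ.m≤n+m _ n) (ℕ.≤-reflexive n+[1+t]M≡c))

representative≥ : ∀ (x : ℤ) M .{{_ : NonZero M}} N → ∃ λ T → N ℕ.≤ T × + T ≡ x mod M
representative≥ x M N = x %ℕ M ℕ.+ N ℕ.* M , ℕ.≤-trans (ℕ.m≤m*n N M) (ℕ.m≤n+m _ _) ,
  mk≡mod (divides (+ N - x /ℕ M) (begin
    + (x %ℕ M ℕ.+ N ℕ.* M) - x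
      ≡⟨ cong₂ _-_ (trans (ℤ.pos-+ (x %ℕ M) _) (cong (λ y → + (x %ℕ M) + y) (ℤ.pos-* N M)))
                   (a≡a%ℕn+[a/ℕn]*n x M) ⟩
    + (x %ℕ M) + + N * + M - (+ (x %ℕ M) + x /ℕ M * + M)
      ≡⟨ cancel (+ (x %ℕ M)) (+ N) (x /ℕ M) (+ M) ⟩
    (+ N - x /ℕ M) * + M ∎))
  where
  open ≡-Reasoning
  cancel : ∀ R N Q M → R + N * M - (R + Q * M) ≡ (N - Q) * M
  cancel = solve-∀

Solvable : ∀ {n} → (Fin n → ℕ) → (Fin n → ℤ) → Set
Solvable m r = ∃ λ x → ∀ k → x ≡ r k mod m k

Compatible : ∀ {n} → (Fin n → ℕ) → (Fin n → ℤ) → Fin n → Fin n → Set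
Compatible m r i j = r i ≡ r j mod gcd (m i) (m j)

pos-isolate : ∀ d y n x m → d ℕ.+ y ℕ.* n ≡ x ℕ.* m → + d ≡ + x * + m + (- + y) * + n
pos-isolate d y n x m eq = begin
  + d                               ≡⟨ isolate (+ d) (+ y) (+ n) ⟩
  (+ d + + y * + n) + (- + y) * + n ≡⟨ cong (λ z → z + (- + y) * + n) cast ⟩
  + x * + m + (- + y) * + n         ∎
  where
  open ≡-Reasoning
  isolate : ∀ D Y N → D ≡ (D + Y * N) + (- Y) * N
  isolate = solve-∀
  cast : + d + + y * + n ≡ + x * + m
  cast = begin
    + d + + y * + n   ≡⟨ cong (λ z → + d + z) (ℤ.pos-* y n) ⟨
    + d + + (y ℕ.* n) ≡⟨ ℤ.pos-+ d (y ℕ.* n) ⟨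
    + (d ℕ.+ y ℕ.* n) ≡⟨ cong +_ eq ⟩
    + (x ℕ.* m)       ≡⟨ ℤ.pos-* x m ⟩
    + x * + m         ∎

bézout : ∀ m n → ∃₂ λ u v → + gcd m n ≡ u * + m + v * + n
bézout m n with Bézout.identity (gcd-GCD m n)
... | Bézout.+- x y eq = + x , - + y , pos-isolate _ y n x m eq
... | Bézout.-+ x y eq = - + x , + y , trans (pos-isolate _ x m y n eq) (ℤ.+-comm (+ y * + n) (- + x * + m))

merge : ∀ m₀ m₁ {x₀ x₁} → x₀ ≡ x₁ mod gcd m₀ m₁ →
        ∃ λ x → x ≡ x₀ mod m₀ × x ≡ x₁ mod m₁ ×
                (∀ {m y} → x₀ ≡ y mod m → x₁ ≡ y mod m → x ≡ y mod m)
merge m₀ m₁ {x₀} {x₁} (mk≡mod (divides δ x₀-x₁≡))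
  with u , v , g≡ ← bézout m₀ m₁
     | divides μ m₁≡ ← ∣ᵤ⇒∣ {+ gcd m₀ m₁} {+ m₁} (gcd[m,n]∣n m₀ m₁) =
  x , mk≡mod (divides (- (δ * u)) x-x₀≡) , mk≡mod (divides (v * δ) x-x₁≡) , common
  where
  open ≡-Reasoning
  G x : ℤ
  G = + gcd m₀ m₁
  -- vμ is 1 modulo m₀/gcd and 0 modulo m₁/gcd = μ.
  x = x₁ + v * μ * (x₀ - x₁)
  G≡ : G ≡ u * + m₀ + v * (μ * G)
  G≡ = trans g≡ (cong (λ z → u * + m₀ + v * z) m₁≡)
  x-x₀≡ : x - x₀ ≡ - (δ * u) * + m₀
  x-x₀≡ = begin
    x - x₀                                          ≡⟨ step₁ x₀ x₁ (v * μ) ⟩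
    (v * μ - + 1) * (x₀ - x₁)                       ≡⟨ cong ((v * μ - + 1) *_) x₀-x₁≡ ⟩
    (v * μ - + 1) * (δ * G)                         ≡⟨ step₂ v μ δ G ⟩
    δ * (v * (μ * G) - G)                           ≡⟨ cong (λ g → δ * (v * (μ * G) - g)) G≡ ⟩
    δ * (v * (μ * G) - (u * + m₀ + v * (μ * G)))   ≡⟨ step₃ δ u v (μ * G) (+ m₀) ⟩
    - (δ * u) * + m₀                                ∎
    where
    step₁ : ∀ x₀ x₁ c → x₁ + c * (x₀ - x₁) - x₀ ≡ (c - + 1) * (x₀ - x₁)
    step₁ = solve-∀
    step₂ : ∀ v μ δ G → (v * μ - + 1) * (δ * G) ≡ δ * (v * (μ * G) - G)
    step₂ = solve-∀
    step₃ : ∀ δ u v B M → δ * (v * B - (u * M + v * B)) ≡ - (δ * u) * M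
    step₃ = solve-∀
  x-x₁≡ : x - x₁ ≡ v * δ * + m₁
  x-x₁≡ = begin
    x - x₁                    ≡⟨ cong (λ d → x₁ + v * μ * d - x₁) x₀-x₁≡ ⟩
    x₁ + v * μ * (δ * G) - x₁ ≡⟨ regroup x₁ v μ δ G ⟩
    v * δ * (μ * G)           ≡⟨ cong (v * δ *_) m₁≡ ⟨
    v * δ * + m₁              ∎
    where
    regroup : ∀ x₁ v μ δ G → x₁ + v * μ * (δ * G) - x₁ ≡ v * δ * (μ * G)
    regroup = solve-∀
  common : ∀ {m y} → x₀ ≡ y mod m → x₁ ≡ y mod m → x ≡ y mod m
  common {m} {y} (mk≡mod m∣x₀-y) (mk≡mod m∣x₁-y) = mk≡mod (subst (+ m ∣_) (affine x₀ x₁ y (v * μ))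
    (∣m∣n⇒∣m+n m∣x₁-y (∣n⇒∣m*n (v * μ) (∣m∣n⇒∣m-n m∣x₀-y m∣x₁-y))))
    where
    affine : ∀ x₀ x₁ y c → (x₁ - y) + c * ((x₀ - y) - (x₁ - y)) ≡ x₁ + c * (x₀ - x₁) - y
    affine = solve-∀

-- The subsystems without the last and without the first congruence are solved recursively;
-- they share the middle congruences, and are glued with merge along the first and last moduli.
crt : ∀ {n} (m : Fin n → ℕ) (r : Fin n → ℤ) → (∀ i j → Compatible m r i j) → Solvable m r
crt {zero}        m r _ = + 0 , λ ()
crt {suc zero}    m r _ = r zero , λ { zero → ≡-mod-refl }
crt {suc (suc n)} m r compatible
  with x₀ , x₀-solves ← crt (m ∘ inject₁) (r ∘ inject₁) (λ i j → compatible (inject₁ i) (inject₁ j))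
     | x₁ , x₁-solves ← crt (m ∘ suc) (r ∘ suc) (λ i j → compatible (suc i) (suc j)) = glued
  where
  last : Fin (suc (suc n))
  last = suc (fromℕ n)

  x₀≡x₁ : x₀ ≡ x₁ mod gcd (m zero) (m last)
  x₀≡x₁ = ≡-mod-trans (≡-mod-∣ (gcd[m,n]∣m (m zero) (m last)) (x₀-solves zero))
            (≡-mod-trans (compatible zero last)
              (≡-mod-sym (≡-mod-∣ (gcd[m,n]∣n (m zero) (m last)) (x₁-solves (fromℕ n)))))

  glued : Solvable m r
  glued = extend (merge (m zero) (m last) x₀≡x₁)
    where
    extend : (∃ λ x → x ≡ x₀ mod m zero × x ≡ x₁ mod m last ×
                (∀ {m′ y} → x₀ ≡ y mod m′ → x₁ ≡ y mod m′ → x ≡ y mod m′)) →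
             Solvable m r
    extend (x , x≡x₀ , x≡x₁ , x-common) = x , solves
      where
      solves : ∀ k → x ≡ r k mod m k
      solves zero = ≡-mod-trans x≡x₀ (x₀-solves zero)
      solves (suc k) with view k
      ... | ‵fromℕ     = ≡-mod-trans x≡x₁ (x₁-solves (fromℕ n))
      ... | ‵inject₁ j = x-common (x₀-solves (suc j)) (x₁-solves (inject₁ j))

-- Partial sums

masked : Bool → ℤ → ℤ
masked b z = if b then z else + 0

sumℤ-filter : ∀ {A : Set} {P : Pred A 0ℓ} (P? : Decidable P) (h : A → ℤ) xs →
              sumℤ (map h (filter P? xs)) ≡ sumℤ (map (λ x → masked (does (P? x)) (h x)) xs)
sumℤ-filter P? h []       = refl
sumℤ-filter P? h (x ∷ xs) with does (P? x)
... | true  = cong (λ s → h x + s) (sumℤ-filter P? h xs)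
... | false = trans (sumℤ-filter P? h xs) (sym (ℤ.+-identityˡ _))

sumℤ-+ : ∀ {A : Set} (f h : A → ℤ) xs →
         sumℤ (map (λ x → f x + h x) xs) ≡ sumℤ (map f xs) + sumℤ (map h xs)
sumℤ-+ f h []       = refl
sumℤ-+ f h (x ∷ xs) = trans (cong (λ s → f x + h x + s) (sumℤ-+ f h xs)) (interchange (f x) (h x) _ _)
  where
  interchange : ∀ a b c d → (a + b) + (c + d) ≡ (a + c) + (b + d)
  interchange = solve-∀

sumℤ-tabulate-at : ∀ {n} (f : Fin n → ℤ) i →
                   sumℤ (tabulate (λ l → masked (toℕ l ℕ.≡ᵇ toℕ i) (f l))) ≡ f i
sumℤ-tabulate-at {suc n} f zero    =
  trans (cong (λ s → f zero + s) (sumℤ-zeros n)) (ℤ.+-identityʳ (f zero))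
  where
  sumℤ-zeros : ∀ n → sumℤ (tabulate {n = n} (λ _ → + 0)) ≡ + 0
  sumℤ-zeros zero    = refl
  sumℤ-zeros (suc n) = trans (ℤ.+-identityˡ _) (sumℤ-zeros n)
sumℤ-tabulate-at {suc n} f (suc i) = trans (ℤ.+-identityˡ _) (sumℤ-tabulate-at (f ∘ suc) i)

masked-split : ∀ l i j z → i < j →
  masked (l ℕ.<ᵇ j) z ≡
  (masked (l ℕ.<ᵇ i) z + masked (l ℕ.≡ᵇ i) z) + masked (l ℕ.<ᵇ j) (masked (i ℕ.<ᵇ l) z)
masked-split zero    zero    (suc j) z _         = sym (trans (ℤ.+-identityʳ _) (ℤ.+-identityˡ z))
masked-split zero    (suc i) (suc j) z _         = sym (trans (ℤ.+-identityʳ _) (ℤ.+-identityʳ z))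
masked-split (suc l) zero    (suc j) z _         = sym (ℤ.+-identityˡ _)
masked-split (suc l) (suc i) (suc j) z (s≤s i<j) = masked-split l i j z i<j

prefix-split : ∀ {n} (ε : Fin n → Sign) (a : Fin n → ℕ) i j → toℕ i < toℕ j →
               prefix ε a j ≡ prefix ε a i + signed (ε i) (a i) + inner ε a i j
prefix-split {n} ε a i j i<j = begin
  prefix ε a j
    ≡⟨ sumℤ-filter (λ l → toℕ l ℕ.<? toℕ j) g all ⟩
  Σ (λ l → masked (toℕ l ℕ.<ᵇ toℕ j) (g l))
    ≡⟨ cong sumℤ (map-cong (λ l → masked-split (toℕ l) (toℕ i) (toℕ j) (g l) i<j) all) ⟩
  Σ (λ l → (before l + at l) + between l)
    ≡⟨ sumℤ-+ (λ l → before l + at l) between all ⟩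
  Σ (λ l → before l + at l) + Σ between
    ≡⟨ cong (_+ Σ between) (sumℤ-+ before at all) ⟩
  (Σ before + Σ at) + Σ between
    ≡⟨ cong₂ (λ p q → p + q + Σ between) Σbefore≡ Σat≡ ⟩
  prefix ε a i + g i + Σ between
    ≡⟨ cong (λ s → prefix ε a i + g i + s) Σbetween≡ ⟨
  prefix ε a i + g i + inner ε a i j ∎
  where
  open ≡-Reasoning
  all : List (Fin n)
  all = allFin n
  g : Fin n → ℤ
  g l = signed (ε l) (a l)
  Σ : (Fin n → ℤ) → ℤ
  Σ h = sumℤ (map h all)
  before at between : Fin n → ℤ
  before  l = masked (toℕ l ℕ.<ᵇ toℕ i) (g l)
  at      l = masked (toℕ l ℕ.≡ᵇ toℕ i) (g l)
  between l = masked (toℕ l ℕ.<ᵇ toℕ j) (masked (toℕ i ℕ.<ᵇ toℕ l) (g l))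
  Σbefore≡ : Σ before ≡ prefix ε a i
  Σbefore≡ = sym (sumℤ-filter (λ l → toℕ l ℕ.<? toℕ i) g all)
  Σat≡ : Σ at ≡ g i
  Σat≡ = trans (cong sumℤ (map-tabulate (λ l → l) at)) (sumℤ-tabulate-at g i)
  Σbetween≡ : inner ε a i j ≡ Σ between
  Σbetween≡ = trans
    (sumℤ-filter (λ l → toℕ i ℕ.<? toℕ l) g (filter (λ l → toℕ l ℕ.<? toℕ j) all))
    (sumℤ-filter (λ l → toℕ l ℕ.<? toℕ j) (λ l → masked (toℕ i ℕ.<ᵇ toℕ l) (g l)) all)

-- Realizability as a system of congruences

residue : ∀ {n} → (Fin n → Sign) → (Fin n → ℕ) → Fin n → ℤ
residue ε a k = source (ε k) (a k) - prefix ε a k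

even-multiple : ∀ j a → 2 ℕ.* j ℕ.* a ≡ j ℕ.* (2 ℕ.* a)
even-multiple = ℕ-solve-∀

odd-multiple : ∀ j a → (2 ℕ.* j ℕ.+ 1) ℕ.* a ≡ a ℕ.+ j ℕ.* (2 ℕ.* a)
odd-multiple = ℕ-solve-∀

StepOK⇒≡-mod : ∀ e {x a} → StepOK e x a → x ≡ source e a mod 2 ℕ.* a
StepOK⇒≡-mod plus  {a = a} (j , x≡) =
  multiple⇒≡-mod 0 (2 ℕ.* a) j (trans x≡ (cong +_ (even-multiple j a)))
StepOK⇒≡-mod minus {a = a} (j , x≡) =
  multiple⇒≡-mod a (2 ℕ.* a) j (trans x≡ (cong +_ (odd-multiple j a)))

≡-mod⇒StepOK : ∀ e {x a} → 0 < a → ℤ.0ℤ ℤ.≤ x → x ≡ source e a mod 2 ℕ.* a → StepOK e x a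
≡-mod⇒StepOK plus {a = a} 0<a 0≤x x≡
  with j , x≡′ ← ≡-mod⇒multiple 0≤x (ℕ.*-monoʳ-< 2 0<a) x≡ =
  j , trans x≡′ (cong +_ (sym (even-multiple j a)))
≡-mod⇒StepOK minus {a = a} 0<a 0≤x x≡
  with j , x≡′ ← ≡-mod⇒multiple 0≤x (n<2*n 0<a) x≡ =
  j , trans x≡′ (cong +_ (sym (odd-multiple j a)))

0≤+n+i : ∀ {n} i → ℤ.∣ i ∣ ℕ.≤ n → ℤ.0ℤ ℤ.≤ + n + i
0≤+n+i (+ m)     _     = +≤+ z≤n
0≤+n+i -[1+ m ] 1+m≤n = subst (ℤ.0ℤ ℤ.≤_) (sym (ℤ.⊖-≥ 1+m≤n)) (+≤+ z≤n)

bounded : ∀ {n} (f : Fin n → ℤ) → ∃ λ N → ∀ k → ℤ.∣ f k ∣ ℕ.≤ N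
bounded {zero}  f = 0 , λ ()
bounded {suc n} f with N , bound ← bounded (f ∘ suc) =
  ℤ.∣ f zero ∣ ℕ.⊔ N , λ { zero → ℕ.m≤m⊔n _ N ; (suc k) → ℕ.m≤n⇒m≤o⊔n _ (bound k) }

common-multiple : ∀ {n} (m : Fin n → ℕ) → (∀ k → NonZero (m k)) →
                  ∃ λ M → NonZero M × (∀ k → m k ℕ.∣ M)
common-multiple m m≢0 =
  product (tabulate m) , product≢0 (tabulate⁺ m≢0) , λ k → ∈⇒∣product (∈-tabulate⁺ k)

WeaklyRealizable⇔Solvable : ∀ {n} (ε : Fin n → Sign) (a : Fin n → ℕ) → (∀ k → 0 < a k) →
                            WeaklyRealizable ε a ⇔ Solvable (λ k → 2 ℕ.* a k) (residue ε a)
WeaklyRealizable⇔Solvable ε a a>0 = mk⇔ realizable⇒solvable solvable⇒realizable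
  where
  shift : ∀ T k → (+ T + prefix ε a k ≡ source (ε k) (a k) mod 2 ℕ.* a k) ⇔
                  (+ T ≡ residue ε a k mod 2 ℕ.* a k)
  shift T k = ≡-mod-shift (+ T) (prefix ε a k) (source (ε k) (a k))

  realizable⇒solvable : WeaklyRealizable ε a → Solvable (λ k → 2 ℕ.* a k) (residue ε a)
  realizable⇒solvable (T , steps) = + T , λ k → to (shift T k) (StepOK⇒≡-mod (ε k) (steps k))

  solvable⇒realizable : Solvable (λ k → 2 ℕ.* a k) (residue ε a) → WeaklyRealizable ε a
  solvable⇒realizable (x , solves)
    with M , M≢0 , 2a∣M ← common-multiple (λ k → 2 ℕ.* a k)
                                           (λ k → ℕ.>-nonZero (ℕ.*-monoʳ-< 2 (a>0 k)))
       | N , bound ← bounded (prefix ε a)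
    with T , N≤T , T≡x ← representative≥ x M {{M≢0}} N =
    T , λ k → ≡-mod⇒StepOK (ε k) (a>0 k) (0≤+n+i (prefix ε a k) (ℕ.≤-trans (bound k) N≤T))
                (from (shift T k) (≡-mod-trans (≡-mod-∣ (2a∣M k) T≡x) (solves k)))

Solvable⇔Compatible : ∀ {n} (m : Fin n → ℕ) (r : Fin n → ℤ) →
                      Solvable m r ⇔ (∀ i j → Compatible m r i j)
Solvable⇔Compatible m r = mk⇔
  (λ (x , solves) i j → ≡-mod-trans (≡-mod-sym (≡-mod-∣ (gcd[m,n]∣m (m i) (m j)) (solves i)))
                                    (≡-mod-∣ (gcd[m,n]∣n (m i) (m j)) (solves j)))
  (crt m r)

Compatible⇔Compatible-< : ∀ {n} (m : Fin n → ℕ) (r : Fin n → ℤ) →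
  (∀ i j → Compatible m r i j) ⇔ (∀ i j → toℕ i < toℕ j → Compatible m r i j)
Compatible⇔Compatible-< m r = mk⇔ (λ compatible i j _ → compatible i j) ordered⇒all
  where
  ordered⇒all : (∀ i j → toℕ i < toℕ j → Compatible m r i j) → ∀ i j → Compatible m r i j
  ordered⇒all compatible i j with ℕ.<-cmp (toℕ i) (toℕ j)
  ... | tri< i<j _ _ = compatible i j i<j
  ... | tri> _ _ j<i =
    subst (λ g → r i ≡ r j mod g) (gcd-comm (m j) (m i)) (≡-mod-sym (compatible j i j<i))
  ... | tri≈ _ i≡j _ with refl ← toℕ-injective i≡j = ≡-mod-refl

Compatible⇔Divisibility×Parity : ∀ {n} (ε : Fin n → Sign) (a : Fin n → ℕ) → (∀ k → 0 < a k) →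
  ∀ i j → toℕ i < toℕ j →
  Compatible (λ k → 2 ℕ.* a k) (residue ε a) i j ⇔ (Divisibility ε a i j × Parity ε a i j)
Compatible⇔Divisibility×Parity ε a a>0 i j i<j = ⇔-trans
  (mk⇔ (λ (mk≡mod d) → subst₂ (λ g x → + g ∣ x) gcd[2ai,2aj]≡ difference d)
       (λ d → mk≡mod (subst₂ (λ g x → + g ∣ x) (sym gcd[2ai,2aj]≡) (sym difference) d)))
  (2gcd∣⇔divisibility×parity (a i) (a j) {{ℕ.>-nonZero (a>0 i)}} {{ℕ.>-nonZero (a>0 j)}}
                              (ε i) (ε j) I)
  where
  I : ℤ
  I = inner ε a i j
  gcd[2ai,2aj]≡ : gcd (2 ℕ.* a i) (2 ℕ.* a j) ≡ 2 ℕ.* gcd (a i) (a j)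
  gcd[2ai,2aj]≡ = sym (c*gcd[m,n]≡gcd[cm,cn] 2 (a i) (a j))
  difference : residue ε a i - residue ε a j ≡ I + (target (ε i) (a i) - source (ε j) (a j))
  difference = begin
    (sᵢ - prefix ε a i) - (sⱼ - prefix ε a j)
      ≡⟨ cong (λ p → (sᵢ - prefix ε a i) - (sⱼ - p)) (prefix-split ε a i j i<j) ⟩
    (sᵢ - prefix ε a i) - (sⱼ - (prefix ε a i + signed (ε i) (a i) + I))
      ≡⟨ regroup sᵢ sⱼ (prefix ε a i) (signed (ε i) (a i)) I ⟩
    I + ((sᵢ + signed (ε i) (a i)) - sⱼ)
      ≡⟨ cong (λ t → I + (t - sⱼ)) (source+signed (ε i) (a i)) ⟩
    I + (target (ε i) (a i) - sⱼ) ∎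
    where
    open ≡-Reasoning
    sᵢ sⱼ : ℤ
    sᵢ = source (ε i) (a i)
    sⱼ = source (ε j) (a j)
    regroup : ∀ sᵢ sⱼ Pᵢ gᵢ I → (sᵢ - Pᵢ) - (sⱼ - (Pᵢ + gᵢ + I)) ≡ I + ((sᵢ + gᵢ) - sⱼ)
    regroup = solve-∀

claim1 : (n : ℕ) (a : Fin n → ℕ) (ε : Fin n → Sign) → (∀ k → 0 < a k) →
    WeaklyRealizable ε a ⇔ (∀ (i j : Fin n) → toℕ i < toℕ j → Divisibility ε a i j × Parity ε a i j)
claim1 n a ε a>0 = begin
  WeaklyRealizable ε a                                 ≈⟨ WeaklyRealizable⇔Solvable ε a a>0 ⟩
  Solvable m r                                         ≈⟨ Solvable⇔Compatible m r ⟩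
  (∀ i j → Compatible m r i j)                         ≈⟨ Compatible⇔Compatible-< m r ⟩
  (∀ i j → toℕ i < toℕ j → Compatible m r i j)         ≈⟨ pointwise ⟩
  (∀ i j → toℕ i < toℕ j → Divisibility ε a i j × Parity ε a i j) ∎
  where
  open SetoidReasoning (⇔-setoid 0ℓ)
  m : Fin n → ℕ
  m k = 2 ℕ.* a k
  r : Fin n → ℤ
  r = residue ε a
  pointwise : (∀ i j → toℕ i < toℕ j → Compatible m r i j) ⇔
              (∀ i j → toℕ i < toℕ j → Divisibility ε a i j × Parity ε a i j)
  pointwise = mk⇔ (λ h i j i<j → to (Compatible⇔Divisibility×Parity ε a a>0 i j i<j) (h i j i<j))
                  (λ h i j i<j → from (Compatible⇔Divisibility×Parity ε a a>0 i j i<j) (h i j i<j))
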